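{- Let $n\ge1$ and let $Q$ be an abundant acyclic quiver on $[n+1]=\{1,\dots,n+1\}$ whose acyclic ordering is $n+1\prec n\prec\cdots\prec1$. Let $\mathbf i$ be a finite mutation sequence that is triangular with respect to $Q$ and such that every $i\in[n]$ appears at least once in $\mathbf i$ while $n+1$ does not appear in $\mathbf i$. Then the c-vector $c^{\mathbf i}_{n+1}$ of $n+1$ in $\mu_{\mathbf i}(Q)$ does not depend on $\mathbf i$: for any other $\mathbf i'$ satisfying the same conditions, $c^{\mathbf i}_{n+1}=c^{\mathbf i'}_{n+1}$.
   Context: A quiver on a finite set $X$ is a function $Q:X\times X\to\mathbb{Z}$ with $Q(x,y)=-Q(y,x)$. Mutation at $x$: $\mu_x(Q)(v,w)=-Q(v,w)$ if $x\in\{v,w\}$, otherwise $Q(v,w)+Q(v,x)[Q(x,w)]_++[-Q(v,x)]_+Q(x,w)$, $[a]_+=\max(a,0)$; for $\mathbf i=(i_1,\dots,i_\ell)$, $\mu_{\mathbf i}=\mu_{i_\ell}\circ\cdots\circ\mu_{i_1}$. $Q$ is abundant if $|Q(x,y)|\ge2$ for all distinct $x,y$. If $Q$ is abundant and acyclic (no oriented cycles), its acyclic order is the linear order with $x\prec y$ iff $Q(x,y)>0$. For an abundant acyclic $Q$ with acyclic order $v_m\prec\cdots\prec v_1$, a finite sequence $\mathbf i$ of vertices with no two consecutive entries equal is triangular with respect to $Q$ if whenever the first appearance of $v_i$ in $\mathbf i$ precedes the first appearance of $v_j$, then $i<j$. Framing: $\hat Q$ is the quiver on $X\sqcup X'$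 ($X'=\{x':x\in X\}$ a disjoint copy) extending $Q$ by one arrow $x\to x'$ for each $x\in X$ (i.e. $\hat Q(x,x')=1$, and $\hat Q$ is zero between frozen vertices and on other mixed pairs); mutations are applied only at vertices of $X$. The c-vector of $x\in X$ in $\mu_{\mathbf i}(Q)$ is $c^{\mathbf i}_x\in\mathbb{Z}^X$ with $y$-entry $\mu_{\mathbf i}(\hat Q)(x,y')$. -}

module Defs where

open import Data.Nat using (ℕ; zero; suc)
open import Data.Integer using (ℤ; +_; -_; _+_; _*_; _⊔_; _≤_; _<_; ∣_∣; 0ℤ)
open import Data.Fin using (Fin; toℕ)
open import Data.Fin.Properties renaming (_≟_ to _≟F_)
open import Data.Sum using (_⊎_; inj₁; inj₂)
open import Data.List using (List; []; _∷_)
open import Data.Product using (_×_; Σ; _,_; ∃)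
open import Data.Empty using (⊥)
open import Relation.Nullary using (¬_; yes; no)
open import Relation.Binary.PropositionalEquality using (_≡_; _≢_)

Quiver : Set → Set
Quiver X = X → X → ℤ

IsSkew : {X : Set} → Quiver X → Set
IsSkew {X} Q = ∀ (x y : X) → Q x y ≡ - Q y x

[_]₊ : ℤ → ℤ
[ a ]₊ = a ⊔ 0ℤ

-- Vertices of the framed quiver on Fin m : mutable (inj₁ x) and frozen (inj₂ x = x').
FV : ℕ → Set
FV m = Fin m ⊎ Fin m

_≟V_ : ∀ {m} (a b : FV m) → Relation.Nullary.Dec (a ≡ b)
inj₁ x ≟V inj₁ y with x ≟F y
... | yes Relation.Binary.PropositionalEquality.refl = yes Relation.Binary.PropositionalEquality.refl
... | no ne = no λ { Relation.Binary.PropositionalEquality.refl → ne Relation.Binary.PropositionalEquality.refl }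
inj₁ x ≟V inj₂ y = no λ ()
inj₂ x ≟V inj₁ y = no λ ()
inj₂ x ≟V inj₂ y with x ≟F y
... | yes Relation.Binary.PropositionalEquality.refl = yes Relation.Binary.PropositionalEquality.refl
... | no ne = no λ { Relation.Binary.PropositionalEquality.refl → ne Relation.Binary.PropositionalEquality.refl }

mutate : ∀ {m} → FV m → Quiver (FV m) → Quiver (FV m)
mutate x Q v w with v ≟V x | w ≟V x
... | yes _ | _     = - Q v w
... | no _  | yes _ = - Q v w
... | no _  | no _  = Q v w + (Q v x * [ Q x w ]₊ + [ - Q v x ]₊ * Q x w)

-- μ_i = μ_{i_ℓ} ∘ ⋯ ∘ μ_{i_1} : mutate at the head first.
mutateSeq : ∀ {m} → List (Fin m) → Quiver (FV m) → Quiver (FV m)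
mutateSeq []       Q = Q
mutateSeq (i ∷ is) Q = mutateSeq is (mutate (inj₁ i) Q)

frame : ∀ {m} → Quiver (Fin m) → Quiver (FV m)
frame Q (inj₁ x) (inj₁ y) = Q x y
frame Q (inj₁ x) (inj₂ y) with x ≟F y
... | yes _ = + 1
... | no _  = 0ℤ
frame Q (inj₂ x) (inj₁ y) with x ≟F y
... | yes _ = - (+ 1)
... | no _  = 0ℤ
frame Q (inj₂ x) (inj₂ y) = 0ℤ

cvec : ∀ {m} → Quiver (Fin m) → List (Fin m) → Fin m → Fin m → ℤ
cvec Q is x y = mutateSeq is (frame Q) (inj₁ x) (inj₂ y)

Abundant : ∀ {m} → Quiver (Fin m) → Set
Abundant Q = ∀ x y → x ≢ y → + 2 ≤ + ∣ Q x y ∣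

-- Acyclic with acyclic order  (m) ≺ (m-1) ≺ ⋯ ≺ 1, where the vertex labelled k
-- is the element of Fin m with toℕ = k - 1: x ≺ y iff Q x y > 0 iff toℕ y < toℕ x.
-- (Together with skew-symmetry and abundance this says exactly that Q is abundant,
-- acyclic, and its acyclic order is the one above.)
HasDecreasingAcyclicOrder : ∀ {m} → Quiver (Fin m) → Set
HasDecreasingAcyclicOrder Q = ∀ x y → toℕ y Data.Nat.< toℕ x → 0ℤ < Q x y

NoRepeat : ∀ {m} → List (Fin m) → Set
NoRepeat []           = Data.Unit.⊤ where import Data.Unit
NoRepeat (a ∷ [])     = Data.Unit.⊤ where import Data.Unit
NoRepeat (a ∷ b ∷ is) = (a ≢ b) × NoRepeat (b ∷ is)

_At_In_ : ∀ {A : Set} → A → ℕ → List A → Set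
a At k In []           = ⊥
a At zero  In (b ∷ is) = a ≡ b
a At suc k In (b ∷ is) = a At k In is

FirstAt : ∀ {A : Set} → A → ℕ → List A → Set
FirstAt a k is = (a At k In is) × (∀ j → j Data.Nat.< k → ¬ (a At j In is))

Triangular : ∀ {m} → List (Fin m) → Set
Triangular is = NoRepeat is ×
  (∀ x y k l → FirstAt x k is → FirstAt y l is → k Data.Nat.< l → toℕ x Data.Nat.< toℕ y)

Appears : ∀ {A : Set} → A → List A → Set
Appears a is = ∃ λ k → a At k In is

-- Mutating the framed quiver at vertex 1 (a sink of Q) produces a fork, in the sense of
-- Warkentin, with point of return 1, and mutating a fork at a vertex other than its point of
-- return produces a fork whose point of return is that vertex. Along a triangular sequence,
-- every vertex already mutated, except the current point of return, sees all vertices not yet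
-- mutated (including n + 1 and the frozen ones) on the same side as n + 1. Mutating at such a
-- vertex again therefore leaves the arrows among the unmutated and frozen vertices unchanged, and
-- those arrows determine what the remaining new mutations do to the row of n + 1. Hence every
-- admissible sequence yields the c-vector of the canonical sequence 1, 2, …, n.
module Submission where

open import Defs

module _ where
  open import Data.Empty using (⊥; ⊥-elim)
  open import Data.Fin using (Fin; zero; suc; toℕ; fromℕ; fromℕ<)
  open import Data.Fin.Properties using (toℕ-injective; toℕ-fromℕ; toℕ-fromℕ<; toℕ<n) renaming (_≟_ to _≟F_)
  open import Data.Integer hiding (suc)
  open import Data.Integer.Properties
  open import Data.Integer.Tactic.RingSolver using (solve-∀)
  open import Data.List using (List; []; _∷_)
  open import Data.List.Relation.Unary.All using (All; []; _∷_)
  open import Data.Nat as ℕ using (ℕ; zero; suc; z≤n; s≤s; _∸_)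
  import Data.Nat.Properties as ℕₚ
  open import Data.Product as Product using (Σ; _×_; _,_; proj₁; proj₂)
  open import Data.Sum as Sum using (_⊎_; inj₁; inj₂)
  open import Data.Sum.Properties using (inj₁-injective)
  open import Data.Unit using (⊤; tt)
  open import Function using (_∘_)
  open import Relation.Binary.Definitions using (DecidableEquality; tri<; tri≈; tri>)
  open import Relation.Binary.PropositionalEquality
    using (_≡_; _≢_; refl; sym; trans; cong; cong₂; subst; subst₂; module ≡-Reasoning)
  open import Relation.Nullary using (¬_; Dec; yes; no)

  -- The mutation rule on integers

  μ-rule : ℤ → ℤ → ℤ → ℤ
  μ-rule a c b = b + (a * [ c ]₊ + [ - a ]₊ * c)

  [i]₊≡i : ∀ {i} → 0ℤ ≤ i → [ i ]₊ ≡ i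
  [i]₊≡i = i≥j⇒i⊔j≡i

  [i]₊≡0 : ∀ {i} → i ≤ 0ℤ → [ i ]₊ ≡ 0ℤ
  [i]₊≡0 = i≤j⇒i⊔j≡j

  [i]₊≡i+[-i]₊ : ∀ i → [ i ]₊ ≡ i + [ - i ]₊
  [i]₊≡i+[-i]₊ i with ≤-total 0ℤ i
  ... | inj₁ 0≤i rewrite [i]₊≡i 0≤i | [i]₊≡0 (neg-mono-≤ 0≤i) = sym (+-identityʳ i)
  ... | inj₂ i≤0 rewrite [i]₊≡0 i≤0 | [i]₊≡i (neg-mono-≤ i≤0) = sym (+-inverseʳ i)

  μ-rule-nonneg-nonneg : ∀ {a c b} → 0ℤ ≤ a → 0ℤ ≤ c → μ-rule a c b ≡ b + a * c
  μ-rule-nonneg-nonneg {a} {c} 0≤a 0≤c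
    rewrite [i]₊≡i 0≤c | [i]₊≡0 (neg-mono-≤ 0≤a) | +-identityʳ (a * c) = refl

  μ-rule-nonpos-nonpos : ∀ {a c b} → a ≤ 0ℤ → c ≤ 0ℤ → μ-rule a c b ≡ b + - a * c
  μ-rule-nonpos-nonpos {a} {c} a≤0 c≤0
    rewrite [i]₊≡0 c≤0 | [i]₊≡i (neg-mono-≤ a≤0) | *-zeroʳ a | +-identityˡ (- a * c) = refl

  μ-rule-nonneg-nonpos : ∀ {a c b} → 0ℤ ≤ a → c ≤ 0ℤ → μ-rule a c b ≡ b
  μ-rule-nonneg-nonpos {a} {b = b} 0≤a c≤0
    rewrite [i]₊≡0 c≤0 | [i]₊≡0 (neg-mono-≤ 0≤a) | *-zeroʳ a = +-identityʳ b

  μ-rule-nonpos-nonneg : ∀ {a c b} → a ≤ 0ℤ → 0ℤ ≤ c → μ-rule a c b ≡ b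
  μ-rule-nonpos-nonneg {a} {c} {b} a≤0 0≤c
    rewrite [i]₊≡i 0≤c | [i]₊≡i (neg-mono-≤ a≤0) | sym (neg-distribˡ-* a c)
          | +-inverseʳ (a * c) = +-identityʳ b

  μ-rule-0ˡ : ∀ c b → μ-rule 0ℤ c b ≡ b
  μ-rule-0ˡ c b = +-identityʳ b

  μ-rule-0ʳ : ∀ a b → μ-rule a 0ℤ b ≡ b
  μ-rule-0ʳ a b rewrite *-zeroʳ a | *-zeroʳ [ - a ]₊ = +-identityʳ b

  μ-rule-neg : ∀ a c b → μ-rule (- a) (- c) (- b) ≡ - μ-rule a c b
  μ-rule-neg a c b rewrite neg-involutive a | [i]₊≡i+[-i]₊ a | [i]₊≡i+[-i]₊ c =
    identity a b c [ - a ]₊ [ - c ]₊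
    where
    identity : ∀ a b c a⁻ c⁻ → - b + (- a * c⁻ + (a + a⁻) * - c) ≡ - (b + (a * (c + c⁻) + a⁻ * c))
    identity = solve-∀

  μ-rule-skew : ∀ a c b → μ-rule a c b ≡ - μ-rule (- c) (- a) (- b)
  μ-rule-skew a c b rewrite neg-involutive c = identity a b c [ c ]₊ [ - a ]₊
    where
    identity : ∀ a b c c⁺ a⁻ → b + (a * c⁺ + a⁻ * c) ≡ - (- b + (- c * a⁻ + c⁺ * - a))
    identity = solve-∀

  0≤i*j : ∀ {i j} → 0ℤ ≤ i → 0ℤ ≤ j → 0ℤ ≤ i * j
  0≤i*j {+ m} {+ n} _ _ rewrite sym (pos-* m n) = +≤+ z≤n

  μ-rule-≥ : ∀ {a c b} → 0ℤ ≤ a ⊎ 0ℤ ≤ c → b ≤ μ-rule a c b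
  μ-rule-≥ {a} {c} {b} h with ≤-total 0ℤ a | ≤-total 0ℤ c | h
  ... | inj₁ 0≤a | inj₁ 0≤c | _ rewrite μ-rule-nonneg-nonneg {b = b} 0≤a 0≤c =
    i≤i+j b (a * c) {{nonNegative (0≤i*j 0≤a 0≤c)}}
  ... | inj₁ 0≤a | inj₂ c≤0 | _ = ≤-reflexive (sym (μ-rule-nonneg-nonpos 0≤a c≤0))
  ... | inj₂ a≤0 | inj₁ 0≤c | _ = ≤-reflexive (sym (μ-rule-nonpos-nonneg a≤0 0≤c))
  ... | inj₂ _   | inj₂ c≤0 | inj₁ 0≤a = ≤-reflexive (sym (μ-rule-nonneg-nonpos 0≤a c≤0))
  ... | inj₂ a≤0 | inj₂ _   | inj₂ 0≤c = ≤-reflexive (sym (μ-rule-nonpos-nonneg a≤0 0≤c))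

  μ-rule-≤ : ∀ {a c b} → a ≤ 0ℤ ⊎ c ≤ 0ℤ → μ-rule a c b ≤ b
  μ-rule-≤ {a} {c} {b} h =
    neg-cancel-≤ (subst (- b ≤_) (μ-rule-neg a c b) (μ-rule-≥ (Sum.map neg-mono-≤ neg-mono-≤ h)))

  ≤-by-difference : ∀ {i j d} → j - i ≡ d → 0ℤ ≤ d → i ≤ j
  ≤-by-difference eq 0≤d = 0≤i-j⇒j≤i (subst (0ℤ ≤_) (sym eq) 0≤d)

  0≤i+j : ∀ {i j} → 0ℤ ≤ i → 0ℤ ≤ j → 0ℤ ≤ i + j
  0≤i+j = +-mono-≤

  0<i⇒0≤i-1 : ∀ {i} → 0ℤ < i → 0ℤ ≤ i - 1ℤ
  0<i⇒0≤i-1 0<i = i≤j⇒0≤j-i (i<j⇒suc[i]≤j 0<i)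

  k≤i+j*k : ∀ {i j k} → 0ℤ ≤ i → 0ℤ < j → 0ℤ < k → k ≤ i + j * k
  k≤i+j*k {i} {j} {k} 0≤i 0<j 0<k = ≤-by-difference (identity i j k)
    (0≤i+j 0≤i (0≤i+j (0≤i*j (0<i⇒0≤i-1 0<j) (0<i⇒0≤i-1 0<k)) (0<i⇒0≤i-1 0<j)))
    where
    identity : ∀ i j k → i + j * k - k ≡ i + ((j - 1ℤ) * (k - 1ℤ) + (j - 1ℤ))
    identity = solve-∀

  j≤i+j*k : ∀ {i j k} → 0ℤ ≤ i → 0ℤ < j → 0ℤ < k → j ≤ i + j * k
  j≤i+j*k {i} {j} {k} 0≤i 0<j 0<k = ≤-by-difference (identity i j k)
    (0≤i+j 0≤i (0≤i+j (0≤i*j (0<i⇒0≤i-1 0<j) (0<i⇒0≤i-1 0<k)) (0<i⇒0≤i-1 0<k)))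
    where
    identity : ∀ i j k → i + j * k - j ≡ i + ((j - 1ℤ) * (k - 1ℤ) + (k - 1ℤ))
    identity = solve-∀

  j≤-i+k*j : ∀ {i j k} → 0ℤ < i → i ≤ j → + 2 ≤ k → j ≤ - i + k * j
  j≤-i+k*j {i} {j} {k} 0<i i≤j 2≤k = ≤-by-difference (identity i j k)
    (0≤i+j (i≤j⇒0≤j-i i≤j) (0≤i*j (i≤j⇒0≤j-i 2≤k) (≤-trans (<⇒≤ 0<i) i≤j)))
    where
    identity : ∀ i j k → - i + k * j - j ≡ (j - i) + (k - + 2) * j
    identity = solve-∀

  k≤-i+k*j : ∀ {i j k} → i ≤ j → + 2 ≤ j → + 2 ≤ k → k ≤ - i + k * j
  k≤-i+k*j {i} {j} {k} i≤j 2≤j 2≤k = ≤-by-difference (identity i j k)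
    (0≤i+j (0≤i+j (0≤i+j (i≤j⇒0≤j-i i≤j) (i≤j⇒0≤j-i 2≤j))
                  (0≤i*j (i≤j⇒0≤j-i 2≤k) (i≤j⇒0≤j-i 2≤j)))
           (i≤j⇒0≤j-i 2≤k))
    where
    identity : ∀ i j k → - i + k * j - k ≡ (j - i) + (j - + 2) + (k - + 2) * (j - + 2) + (k - + 2)
    identity = solve-∀

  i+j*-k≤0 : ∀ {i j k} → 0ℤ < i → i ≤ j → 0ℤ < k → i + j * - k ≤ 0ℤ
  i+j*-k≤0 {i} {j} {k} 0<i i≤j 0<k = ≤-by-difference (identity i j k)
    (0≤i+j (i≤j⇒0≤j-i i≤j) (0≤i*j (≤-trans (<⇒≤ 0<i) i≤j) (0<i⇒0≤i-1 0<k)))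
    where
    identity : ∀ i j k → 0ℤ - (i + j * - k) ≡ (j - i) + j * (k - 1ℤ)
    identity = solve-∀

  -- Framed quivers and forks

  Mutable : ∀ {m} → FV m → Set
  Mutable (inj₁ _) = ⊤
  Mutable (inj₂ _) = ⊥

  TwoMutable : ∀ {m} → FV m → FV m → FV m → Set
  TwoMutable u v w = Mutable u × Mutable v ⊎ Mutable v × Mutable w ⊎ Mutable w × Mutable u

  module _ {m} {u v w : FV m} where
    TwoMutable-rotate : TwoMutable u v w → TwoMutable v w u
    TwoMutable-rotate (inj₁ uv) = inj₂ (inj₂ uv)
    TwoMutable-rotate (inj₂ (inj₁ vw)) = inj₁ vw
    TwoMutable-rotate (inj₂ (inj₂ wu)) = inj₂ (inj₁ wu)

    TwoMutable-reverse : TwoMutable u v w → TwoMutable u w v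
    TwoMutable-reverse (inj₁ (u , v)) = inj₂ (inj₂ (v , u))
    TwoMutable-reverse (inj₂ (inj₁ (v , w))) = inj₂ (inj₁ (w , v))
    TwoMutable-reverse (inj₂ (inj₂ (w , u))) = inj₁ (u , w)

    TwoMutable⇒Mutable⊎Mutable : TwoMutable u v w → Mutable u ⊎ Mutable v
    TwoMutable⇒Mutable⊎Mutable (inj₁ (u , _)) = inj₁ u
    TwoMutable⇒Mutable⊎Mutable (inj₂ (inj₁ (v , _))) = inj₂ v
    TwoMutable⇒Mutable⊎Mutable (inj₂ (inj₂ (_ , u))) = inj₁ u

    TwoMutable-frozen : TwoMutable u v w → ¬ Mutable w → Mutable u × Mutable v
    TwoMutable-frozen (inj₁ uv) _ = uv
    TwoMutable-frozen (inj₂ (inj₁ (_ , w))) ¬w = ⊥-elim (¬w w)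
    TwoMutable-frozen (inj₂ (inj₂ (w , _))) ¬w = ⊥-elim (¬w w)

  negate : ∀ {X : Set} → Quiver X → Quiver X
  negate B v w = - B v w

  module _ {X : Set} {B : Quiver X} (skew : IsSkew B) where
    skew-diagonal : ∀ v → B v v ≡ 0ℤ
    skew-diagonal v = i≡-i⇒i≡0 (skew v v)
      where
      i≡-i⇒i≡0 : ∀ {i} → i ≡ - i → i ≡ 0ℤ
      i≡-i⇒i≡0 {+0} _ = refl

    skew-pos : ∀ {v w} → 0ℤ < B v w → B w v < 0ℤ
    skew-pos {v} {w} h = subst (_< 0ℤ) (sym (skew w v)) (neg-mono-< h)

    skew-neg : ∀ {v w} → B v w < 0ℤ → 0ℤ < B w v
    skew-neg {v} {w} h = subst (0ℤ <_) (sym (skew w v)) (neg-mono-< h)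

    skew-asym : ∀ {v w} → 0ℤ < B v w → 0ℤ < B w v → ⊥
    skew-asym h h′ = <-asym h (skew-pos h′)

    skew-pos⇒≢ : ∀ {v w} → 0ℤ < B v w → v ≢ w
    skew-pos⇒≢ {v} h refl = <-irrefl (sym (skew-diagonal v)) h

  module _ {m} (x : FV m) (B : Quiver (FV m)) where
    mutate-row : ∀ w → mutate x B x w ≡ - B x w
    mutate-row w with x ≟V x
    ... | yes _ = refl
    ... | no x≢x = ⊥-elim (x≢x refl)

    mutate-column : ∀ {v} → v ≢ x → mutate x B v x ≡ - B v x
    mutate-column {v} v≢x with v ≟V x | x ≟V x
    ... | yes v≡x | _ = ⊥-elim (v≢x v≡x)
    ... | no _ | yes _ = refl
    ... | no _ | no x≢x = ⊥-elim (x≢x refl)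

    mutate-off : ∀ {v w} → v ≢ x → w ≢ x → mutate x B v w ≡ μ-rule (B v x) (B x w) (B v w)
    mutate-off {v} {w} v≢x w≢x with v ≟V x | w ≟V x
    ... | yes v≡x | _ = ⊥-elim (v≢x v≡x)
    ... | no _ | yes w≡x = ⊥-elim (w≢x w≡x)
    ... | no _ | no _ = refl

    mutate-skew : IsSkew B → IsSkew (mutate x B)
    mutate-skew skew v w with v ≟V x | w ≟V x
    ... | yes refl | yes refl = cong -_ (skew x x)
    ... | yes refl | no _ = cong -_ (skew x w)
    ... | no _ | yes refl = cong -_ (skew v x)
    ... | no _ | no _ rewrite skew w x | skew x v | skew w v = μ-rule-skew (B v x) (B x w) (B v w)

    mutate-negate : ∀ v w → mutate x (negate B) v w ≡ - mutate x B v w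
    mutate-negate v w with v ≟V x | w ≟V x
    ... | yes _ | _ = refl
    ... | no _ | yes _ = refl
    ... | no _ | no _ = μ-rule-neg (B v x) (B x w) (B v w)

  AbundantEntry : ℤ → Set
  AbundantEntry i = + 2 ≤ + ∣ i ∣

  AbundantEntry-neg : ∀ {i} → AbundantEntry i → AbundantEntry (- i)
  AbundantEntry-neg {i} = subst (λ n → + 2 ≤ + n) (sym (∣-i∣≡∣i∣ i))

  2≤i⇒AbundantEntry : ∀ {i} → + 2 ≤ i → AbundantEntry i
  2≤i⇒AbundantEntry {+ _} 2≤i = 2≤i

  AbundantEntry-pos : ∀ {i} → AbundantEntry i → 0ℤ < i → + 2 ≤ i
  AbundantEntry-pos {+ _} h _ = h

  AbundantEntry⇒≢0 : ∀ {i} → AbundantEntry i → i ≢ 0ℤ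
  AbundantEntry⇒≢0 {+0} (+≤+ ())
  AbundantEntry⇒≢0 { +[1+ _ ]} _ ()
  AbundantEntry⇒≢0 { -[1+ _ ]} _ ()

  AbundantEntry-sign : ∀ {i} → AbundantEntry i → 0ℤ < i ⊎ i < 0ℤ
  AbundantEntry-sign { +[1+ _ ]} _ = inj₁ (+<+ (s≤s z≤n))
  AbundantEntry-sign { -[1+ _ ]} _ = inj₂ -<+
  AbundantEntry-sign {+0} (+≤+ ())

  -- Frozen
  -- vertices only carry the single framing arrows, so the weight bounds are required only at
  -- mutable endpoints and the cycle condition only for triangles with at most one frozen vertex.
  record IsFork {m} (B : Quiver (FV m)) (r : Fin m) : Set where
    field
      skew : IsSkew B
      abundant : ∀ x y → x ≢ y → AbundantEntry (B (inj₁ x) (inj₁ y))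
      closing-arrow-dominates : ∀ v w → 0ℤ < B v (inj₁ r) → 0ℤ < B (inj₁ r) w →
        (Mutable w → B v (inj₁ r) ≤ B w v) × (Mutable v → B (inj₁ r) w ≤ B w v)
      acyclic-off-return : ∀ u v w → u ≢ inj₁ r → v ≢ inj₁ r → w ≢ inj₁ r → TwoMutable u v w →
        0ℤ < B u v → 0ℤ < B v w → 0ℤ < B w u → ⊥

    abundant-mutable : ∀ {u v} → Mutable u → Mutable v → u ≢ v → AbundantEntry (B u v)
    abundant-mutable {inj₁ x} {inj₁ y} _ _ u≢v = abundant x y (u≢v ∘ cong inj₁)

    sign-between-mutable : ∀ {u v} → Mutable u → Mutable v → u ≢ v → 0ℤ < B u v ⊎ B u v < 0ℤ
    sign-between-mutable mu mv u≢v = AbundantEntry-sign (abundant-mutable mu mv u≢v)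

    pos⇒2≤ : ∀ {u v} → Mutable u → Mutable v → 0ℤ < B u v → + 2 ≤ B u v
    pos⇒2≤ mu mv h = AbundantEntry-pos (abundant-mutable mu mv (skew-pos⇒≢ skew h)) h

  module _ {m} {B : Quiver (FV m)} {r : Fin m} where
    IsFork-resp : ∀ {B′} → (∀ v w → B v w ≡ B′ v w) → IsFork B r → IsFork B′ r
    IsFork-resp {B′} eq F = record
      { skew = λ v w → trans (sym (eq v w)) (trans (skew v w) (cong -_ (eq w v)))
      ; abundant = λ x y x≢y → subst AbundantEntry (eq _ _) (abundant x y x≢y)
      ; closing-arrow-dominates = λ v w h₁ h₂ →
          Product.map (≤-resp ∘_) (≤-resp ∘_) (closing-arrow-dominates v w (unresp h₁) (unresp h₂))
      ; acyclic-off-return = λ u v w u≢R v≢R w≢R t h₁ h₂ h₃ →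
          acyclic-off-return u v w u≢R v≢R w≢R t (unresp h₁) (unresp h₂) (unresp h₃)
      }
      where
      open IsFork F
      unresp : ∀ {v w} → 0ℤ < B′ v w → 0ℤ < B v w
      unresp {v} {w} = subst (0ℤ <_) (sym (eq v w))
      ≤-resp : ∀ {a b c d} → B a b ≤ B c d → B′ a b ≤ B′ c d
      ≤-resp = subst₂ _≤_ (eq _ _) (eq _ _)

    IsFork-negate : IsFork B r → IsFork (negate B) r
    IsFork-negate F = record
      { skew = λ v w → cong -_ (skew v w)
      ; abundant = λ x y x≢y → AbundantEntry-neg {B (inj₁ x) (inj₁ y)} (abundant x y x≢y)
      ; closing-arrow-dominates = λ v w h₁ h₂ →
          let (if-v , if-w) = closing-arrow-dominates w v (flip h₂) (flip h₁)
          in (λ mw → subst₂ _≤_ (skew R v) (skew v w) (if-w mw)) ,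
             (λ mv → subst₂ _≤_ (skew w R) (skew v w) (if-v mv))
      ; acyclic-off-return = λ u v w u≢R v≢R w≢R t h₁ h₂ h₃ →
          acyclic-off-return u w v u≢R w≢R v≢R (TwoMutable-reverse t) (flip h₃) (flip h₂) (flip h₁)
      }
      where
      open IsFork F
      R : FV m
      R = inj₁ r
      flip : ∀ {v w} → 0ℤ < - B v w → 0ℤ < B w v
      flip {v} {w} = subst (0ℤ <_) (sym (skew w v))

  mutate-abundant : ∀ {m} {B : Quiver (FV m)} {k} →
    (∀ x y → x ≢ y → AbundantEntry (B (inj₁ x) (inj₁ y))) →
    (∀ {x y} → x ≢ y → x ≢ k → y ≢ k → AbundantEntry (mutate (inj₁ k) B (inj₁ x) (inj₁ y))) →
    ∀ x y → x ≢ y → AbundantEntry (mutate (inj₁ k) B (inj₁ x) (inj₁ y))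
  mutate-abundant {m} {B} {k} abundant abundant-off x y x≢y = by-cases (x ≟F k) (y ≟F k)
    where
    K : FV m
    K = inj₁ k
    by-cases : Dec (x ≡ k) → Dec (y ≡ k) → AbundantEntry (mutate K B (inj₁ x) (inj₁ y))
    by-cases (yes x≡k) _ = subst (λ x → AbundantEntry (mutate K B (inj₁ x) (inj₁ y))) (sym x≡k)
      (subst AbundantEntry (sym (mutate-row K B (inj₁ y)))
        (AbundantEntry-neg {B K (inj₁ y)} (abundant k y (x≢y ∘ trans x≡k))))
    by-cases (no x≢k) (yes y≡k) = subst (λ y → AbundantEntry (mutate K B (inj₁ x) (inj₁ y))) (sym y≡k)
      (subst AbundantEntry (sym (mutate-column K B (x≢k ∘ inj₁-injective)))
        (AbundantEntry-neg {B (inj₁ x) K} (abundant x k (x≢y ∘ λ x≡k → trans x≡k (sym y≡k)))))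
    by-cases (no x≢k) (no y≢k) = abundant-off x≢y x≢k y≢k

  module ForkMutation {m} {B : Quiver (FV m)} {r k : Fin m} (F : IsFork B r) (k≢r : k ≢ r)
                      (r→k : 0ℤ < B (inj₁ r) (inj₁ k)) where
    open IsFork F

    R K : FV m
    R = inj₁ r
    K = inj₁ k

    B′ : Quiver (FV m)
    B′ = mutate K B

    K≢R : K ≢ R
    K≢R = k≢r ∘ inj₁-injective

    R≢K : R ≢ K
    R≢K = K≢R ∘ sym

    source≢K : ∀ {v} → 0ℤ < B v K → v ≢ K
    source≢K = skew-pos⇒≢ skew

    target≢K : ∀ {w} → 0ℤ < B K w → w ≢ K
    target≢K h = skew-pos⇒≢ skew h ∘ sym

    from-K⇒≢R : ∀ {v} → 0ℤ < B K v → v ≢ R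
    from-K⇒≢R k→v refl = skew-asym skew r→k k→v

    into-R⇒heavier-from-K : ∀ {x} → 0ℤ < B x R → B x R ≤ B K x
    into-R⇒heavier-from-K {x} x→r = proj₁ (closing-arrow-dominates x K x→r r→k) tt

    into-R⇒from-K : ∀ {x} → 0ℤ < B x R → 0ℤ < B K x
    into-R⇒from-K x→r = <-≤-trans x→r (into-R⇒heavier-from-K x→r)

    B′-skew : IsSkew B′
    B′-skew = mutate-skew K B skew

    B′[K,w] : ∀ w → B′ K w ≡ B w K
    B′[K,w] w = trans (mutate-row K B w) (sym (skew w K))

    B′[v,K] : ∀ {v} → v ≢ K → B′ v K ≡ B K v
    B′[v,K] {v} v≢K = trans (mutate-column K B v≢K) (sym (skew K v))

    B′-off : ∀ {v w} → v ≢ K → w ≢ K → B′ v w ≡ μ-rule (B v K) (B K w) (B v w)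
    B′-off = mutate-off K B

    B′≤B : ∀ {u v} → u ≢ K → v ≢ K → B u K ≤ 0ℤ ⊎ B K v ≤ 0ℤ → B′ u v ≤ B u v
    B′≤B u≢K v≢K h = subst (_≤ _) (sym (B′-off u≢K v≢K)) (μ-rule-≤ h)

    -- For w ≢ R acyclicity away from R gives 0 ≤ B w v; for w ≡ R the fork inequality at R
    -- bounds B v R by B K v.
    closing-bounds : ∀ {v w} → 0ℤ < B K v → 0ℤ < B w K →
      (Mutable w → B K v ≤ B w v + B w K * B K v) × (Mutable v → B w K ≤ B w v + B w K * B K v)
    closing-bounds {v} {w} k→v w→k with w ≟V R
    ... | no w≢R = (λ mw → k≤i+j*k (0≤B[w,v] (inj₁ (mw , tt))) w→k k→v) ,
                   (λ mv → j≤i+j*k (0≤B[w,v] (inj₂ (inj₁ (tt , mv)))) w→k k→v)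
      where
      0≤B[w,v] : TwoMutable w K v → 0ℤ ≤ B w v
      0≤B[w,v] t = ≮⇒≥ λ v→w →
        acyclic-off-return w K v w≢R K≢R (from-K⇒≢R k→v) t w→k k→v (skew-neg skew v→w)
    ... | yes refl with 0ℤ <? B v R
    ...   | no v↛r = (λ _ → k≤i+j*k 0≤B[R,v] r→k k→v) , (λ _ → j≤i+j*k 0≤B[R,v] r→k k→v)
      where
      0≤B[R,v] : 0ℤ ≤ B R v
      0≤B[R,v] = subst (0ℤ ≤_) (sym (skew R v)) (neg-mono-≤ (≮⇒≥ v↛r))
    ...   | yes v→r rewrite skew R v =
      (λ _ → j≤-i+k*j v→r (into-R⇒heavier-from-K v→r) (pos⇒2≤ tt tt r→k)) ,
      (λ mv → k≤-i+k*j (into-R⇒heavier-from-K v→r) (pos⇒2≤ tt mv k→v) (pos⇒2≤ tt tt r→k))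

    closing-arrow-dominates′ : ∀ v w → 0ℤ < B′ v K → 0ℤ < B′ K w →
      (Mutable w → B′ v K ≤ B′ w v) × (Mutable v → B′ K w ≤ B′ w v)
    closing-arrow-dominates′ v w h₁ h₂ =
      Product.map (λ f mw → subst₂ _≤_ (sym B′[v,K]′) (sym B′[w,v]) (f mw))
                  (λ f mv → subst₂ _≤_ (sym (B′[K,w] w)) (sym B′[w,v]) (f mv))
                  (closing-bounds k→v w→k)
      where
      v≢K : v ≢ K
      v≢K = skew-pos⇒≢ B′-skew h₁
      w≢K : w ≢ K
      w≢K = skew-pos⇒≢ B′-skew h₂ ∘ sym
      B′[v,K]′ : B′ v K ≡ B K v
      B′[v,K]′ = B′[v,K] v≢K
      k→v : 0ℤ < B K v
      k→v = subst (0ℤ <_) B′[v,K]′ h₁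
      w→k : 0ℤ < B w K
      w→k = subst (0ℤ <_) (B′[K,w] w) h₂
      B′[w,v] : B′ w v ≡ B w v + B w K * B K v
      B′[w,v] = trans (B′-off w≢K v≢K) (μ-rule-nonneg-nonneg {b = B w v} (<⇒≤ w→k) (<⇒≤ k→v))

    B′-into-K : ∀ {u} → 0ℤ < B K u → 0ℤ < B′ u K
    B′-into-K k→u = subst (0ℤ <_) (sym (B′[v,K] (target≢K k→u))) k→u

    B′-out-of-K : ∀ {v} → 0ℤ < B v K → 0ℤ < B′ K v
    B′-out-of-K {v} = subst (0ℤ <_) (sym (B′[K,w] v))

    B′-closing-pos : ∀ {u v} → 0ℤ < B K u → 0ℤ < B v K → Mutable u ⊎ Mutable v → 0ℤ < B′ v u
    B′-closing-pos k→u v→k mu⊎mv with closing-arrow-dominates′ _ _ (B′-into-K k→u) (B′-out-of-K v→k)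
    ... | if-v , if-u = Sum.[ (λ mu → <-≤-trans (B′-out-of-K v→k) (if-u mu))
                            , (λ mv → <-≤-trans (B′-into-K k→u) (if-v mv)) ] mu⊎mv

    B′-closing-heavy : ∀ {u v} → Mutable u → Mutable v → 0ℤ < B K u → 0ℤ < B v K → + 2 ≤ B′ v u
    B′-closing-heavy mu mv k→u v→k =
      ≤-trans (subst (+ 2 ≤_) (sym (B′[v,K] (target≢K k→u))) (pos⇒2≤ tt mu k→u))
              (proj₁ (closing-arrow-dominates′ _ _ (B′-into-K k→u) (B′-out-of-K v→k)) mv)

    B′-abundant-off : ∀ {x y} → x ≢ y → x ≢ k → y ≢ k → AbundantEntry (B′ (inj₁ x) (inj₁ y))
    B′-abundant-off {x} {y} x≢y x≢k y≢k =
      by-signs (AbundantEntry-sign (abundant x k x≢k)) (AbundantEntry-sign (abundant k y (y≢k ∘ sym)))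
      where
      X Y : FV m
      X = inj₁ x
      Y = inj₁ y
      unchanged : μ-rule (B X K) (B K Y) (B X Y) ≡ B X Y → AbundantEntry (B′ X Y)
      unchanged eq = subst AbundantEntry
        (sym (trans (B′-off (x≢k ∘ inj₁-injective) (y≢k ∘ inj₁-injective)) eq)) (abundant x y x≢y)
      by-signs : 0ℤ < B X K ⊎ B X K < 0ℤ → 0ℤ < B K Y ⊎ B K Y < 0ℤ → AbundantEntry (B′ X Y)
      by-signs (inj₁ x→k) (inj₁ k→y) = 2≤i⇒AbundantEntry (B′-closing-heavy tt tt k→y x→k)
      by-signs (inj₂ k→x) (inj₂ y→k) = subst AbundantEntry (sym (B′-skew X Y))
        (AbundantEntry-neg {B′ Y X} (2≤i⇒AbundantEntry
          (B′-closing-heavy tt tt (skew-neg skew k→x) (skew-neg skew y→k))))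
      by-signs (inj₁ x→k) (inj₂ y→k) = unchanged (μ-rule-nonneg-nonpos (<⇒≤ x→k) (<⇒≤ y→k))
      by-signs (inj₂ k→x) (inj₁ k→y) = unchanged (μ-rule-nonpos-nonneg (<⇒≤ k→x) (<⇒≤ k→y))

    B′-into-R≤0 : ∀ {x} → x ≢ K → B′ x R ≤ 0ℤ
    B′-into-R≤0 {x} x≢K with 0ℤ <? B x R
    ... | no x↛r = ≤-trans (B′≤B x≢K R≢K (inj₂ (<⇒≤ (skew-pos skew r→k)))) (≮⇒≥ x↛r)
    ... | yes x→r = subst (_≤ 0ℤ) (sym B′[x,R]) (i+j*-k≤0 x→r (into-R⇒heavier-from-K x→r) r→k)
      where
      open ≡-Reasoning
      B′[x,R] : B′ x R ≡ B x R + B K x * - B R K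
      B′[x,R] = begin
        B′ x R                          ≡⟨ B′-off x≢K R≢K ⟩
        μ-rule (B x K) (B K R) (B x R)  ≡⟨ μ-rule-nonpos-nonpos {b = B x R}
                                             (<⇒≤ (skew-pos skew (into-R⇒from-K x→r))) (<⇒≤ (skew-pos skew r→k)) ⟩
        B x R + - B x K * B K R         ≡⟨ cong₂ (λ a c → B x R + a * c) (sym (skew K x)) (skew K R) ⟩
        B x R + B K x * - B R K         ∎

    B′-target≢R : ∀ {v x} → v ≢ K → 0ℤ < B′ v x → x ≢ R
    B′-target≢R v≢K h refl = <-irrefl refl (<-≤-trans h (B′-into-R≤0 v≢K))

    B′-pos⇒ : ∀ {u v} → u ≢ K → v ≢ K → 0ℤ < B′ u v →
              0ℤ < B u v ⊎ (0ℤ < B u K × 0ℤ < B K v)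
    B′-pos⇒ {u} {v} u≢K v≢K h with 0ℤ <? B u K | 0ℤ <? B K v
    ... | yes u→k | yes k→v = inj₂ (u→k , k→v)
    ... | no u↛k | _ = inj₁ (<-≤-trans h (B′≤B u≢K v≢K (inj₁ (≮⇒≥ u↛k))))
    ... | yes _ | no k↛v = inj₁ (<-≤-trans h (B′≤B u≢K v≢K (inj₂ (≮⇒≥ k↛v))))

    apart⇒frozen : ∀ {w} → w ≢ K → B w K ≡ 0ℤ → ¬ Mutable w
    apart⇒frozen w≢K w-apart mw = AbundantEntry⇒≢0 (abundant-mutable mw tt w≢K) w-apart

    B′-from-apart : ∀ {w u} → w ≢ K → u ≢ K → B w K ≡ 0ℤ → B′ w u ≡ B w u
    B′-from-apart {w} {u} w≢K u≢K w-apart = begin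
      B′ w u                         ≡⟨ B′-off w≢K u≢K ⟩
      μ-rule (B w K) (B K u) (B w u) ≡⟨ cong (λ a → μ-rule a (B K u) (B w u)) w-apart ⟩
      μ-rule 0ℤ (B K u) (B w u)      ≡⟨ μ-rule-0ˡ (B K u) (B w u) ⟩
      B w u                          ∎
      where open ≡-Reasoning

    B′-to-apart : ∀ {v w} → v ≢ K → w ≢ K → B w K ≡ 0ℤ → B′ v w ≡ B v w
    B′-to-apart {v} {w} v≢K w≢K w-apart = begin
      B′ v w                         ≡⟨ B′-off v≢K w≢K ⟩
      μ-rule (B v K) (B K w) (B v w) ≡⟨ cong (λ c → μ-rule (B v K) c (B v w))
                                           (trans (skew K w) (cong -_ w-apart)) ⟩
      μ-rule (B v K) 0ℤ (B v w)      ≡⟨ μ-rule-0ʳ (B v K) (B v w) ⟩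
      B v w                          ∎
      where open ≡-Reasoning

    no-cycle-via-apart : ∀ {u v w} → w ≢ K → TwoMutable u v w → B w K ≡ 0ℤ →
                         0ℤ < B u K → 0ℤ < B K v → 0ℤ < B′ v w → 0ℤ < B′ w u → ⊥
    no-cycle-via-apart {u} {v} {w} w≢K t w-apart u→k k→v h₂ h₃
      with TwoMutable-frozen t (apart⇒frozen w≢K w-apart)
    ... | mu , mv with sign-between-mutable mu mv (λ { refl → skew-asym skew u→k k→v })
    ...   | inj₁ u→v = acyclic-off-return u v w (B′-target≢R w≢K h₃) (from-K⇒≢R k→v)
                         (λ { refl → apart⇒frozen w≢K w-apart tt }) t u→v
                         (subst (0ℤ <_) (B′-to-apart (target≢K k→v) w≢K w-apart) h₂)
                         (subst (0ℤ <_) (B′-from-apart w≢K (source≢K u→k) w-apart) h₃)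
    ...   | inj₂ v→u = acyclic-off-return u K v (B′-target≢R w≢K h₃) K≢R (from-K⇒≢R k→v)
                         (inj₁ (mu , tt)) u→k k→v (skew-neg skew v→u)

    no-cycle-after-new-arrow : ∀ {u v w} → w ≢ K → TwoMutable u v w → 0ℤ < B u K → 0ℤ < B K v →
                               0ℤ < B′ v w → 0ℤ < B′ w u → ⊥
    no-cycle-after-new-arrow {u} {v} {w} w≢K t u→k k→v h₂ h₃ with <-cmp 0ℤ (B w K)
    ... | tri< w→k _ _ = skew-asym B′-skew {v} {w} h₂
                           (B′-closing-pos k→v w→k (TwoMutable⇒Mutable⊎Mutable (TwoMutable-rotate t)))
    ... | tri> _ _ k→w = skew-asym B′-skew {w} {u} h₃
                           (B′-closing-pos (skew-neg skew k→w) u→k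
                             (TwoMutable⇒Mutable⊎Mutable (TwoMutable-rotate (TwoMutable-rotate t))))
    ... | tri≈ _ 0≡B[w,K] _ = no-cycle-via-apart w≢K t (sym 0≡B[w,K]) u→k k→v h₂ h₃

    -- An arrow of B′ away from K is either an arrow of B or comes from a path u → K → v in B.
    -- In B′ no arrow leads from an out-neighbour of K back to an in-neighbour, so a cycle using
    -- such a new arrow must pass through a vertex apart from K.
    B′-acyclic : ∀ u v w → u ≢ K → v ≢ K → w ≢ K → TwoMutable u v w →
                 0ℤ < B′ u v → 0ℤ < B′ v w → 0ℤ < B′ w u → ⊥
    B′-acyclic u v w u≢K v≢K w≢K t h₁ h₂ h₃
      with B′-pos⇒ u≢K v≢K h₁ | B′-pos⇒ v≢K w≢K h₂ | B′-pos⇒ w≢K u≢K h₃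
    ... | inj₁ u→v | inj₁ v→w | inj₁ w→u =
      acyclic-off-return u v w (B′-target≢R w≢K h₃) (B′-target≢R u≢K h₁) (B′-target≢R v≢K h₂)
        t u→v v→w w→u
    ... | inj₂ (u→k , k→v) | _ | _ = no-cycle-after-new-arrow w≢K t u→k k→v h₂ h₃
    ... | inj₁ _ | inj₂ (v→k , k→w) | _ =
      no-cycle-after-new-arrow u≢K (TwoMutable-rotate t) v→k k→w h₃ h₁
    ... | inj₁ _ | inj₁ _ | inj₂ (w→k , k→u) =
      no-cycle-after-new-arrow v≢K (TwoMutable-rotate (TwoMutable-rotate t)) w→k k→u h₁ h₂

    mutated : IsFork B′ k
    mutated = record
      { skew = B′-skew
      ; abundant = mutate-abundant abundant B′-abundant-off
      ; closing-arrow-dominates = closing-arrow-dominates′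
      ; acyclic-off-return = B′-acyclic
      }

  -- Negating every arrow commutes with mutation and preserves forks, so it suffices to treat r → k.
  mutate-fork : ∀ {m} {B : Quiver (FV m)} {r k} → IsFork B r → k ≢ r → IsFork (mutate (inj₁ k) B) k
  mutate-fork {B = B} {r} {k} F k≢r with AbundantEntry-sign (IsFork.abundant F r k (k≢r ∘ sym))
  ... | inj₁ r→k = ForkMutation.mutated F k≢r r→k
  ... | inj₂ k→r =
    IsFork-resp (λ v w → trans (cong -_ (mutate-negate (inj₁ k) B v w)) (neg-involutive _))
                (IsFork-negate (ForkMutation.mutated (IsFork-negate F) k≢r (neg-mono-< k→r)))

  SameSide : ℤ → ℤ → Set
  SameSide i j = 0ℤ ≤ i × 0ℤ ≤ j ⊎ i ≤ 0ℤ × j ≤ 0ℤ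

  SameSide-neg : ∀ {i j} → SameSide i j → SameSide (- i) (- j)
  SameSide-neg (inj₁ (0≤i , 0≤j)) = inj₂ (neg-mono-≤ 0≤i , neg-mono-≤ 0≤j)
  SameSide-neg (inj₂ (i≤0 , j≤0)) = inj₁ (neg-mono-≤ i≤0 , neg-mono-≤ j≤0)

  SameSide-nonneg : ∀ {i j} → SameSide i j → 0ℤ < j → 0ℤ ≤ i
  SameSide-nonneg (inj₁ (0≤i , _)) _ = 0≤i
  SameSide-nonneg (inj₂ (_ , j≤0)) 0<j = ⊥-elim (<-irrefl refl (<-≤-trans 0<j j≤0))

  SameSide-nonpos : ∀ {i j} → SameSide i j → j < 0ℤ → i ≤ 0ℤ
  SameSide-nonpos (inj₂ (i≤0 , _)) _ = i≤0
  SameSide-nonpos (inj₁ (_ , 0≤j)) j<0 = ⊥-elim (<-irrefl refl (<-≤-trans j<0 0≤j))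

  mutate-fork-old-return : ∀ {m} {B : Quiver (FV m)} {r k} → IsFork B r → k ≢ r →
    ∀ {x y} → x ≢ inj₁ k → y ≢ inj₁ k →
    SameSide (mutate (inj₁ k) B x (inj₁ r)) (mutate (inj₁ k) B y (inj₁ r))
  mutate-fork-old-return {B = B} {r} {k} F k≢r {x} {y} x≢K y≢K
    with AbundantEntry-sign (IsFork.abundant F r k (k≢r ∘ sym))
  ... | inj₁ r→k = inj₂ (B′-into-R≤0 x≢K , B′-into-R≤0 y≢K)
    where open ForkMutation F k≢r r→k
  ... | inj₂ k→r = inj₁ (flip {x} (B′-into-R≤0 x≢K) , flip {y} (B′-into-R≤0 y≢K))
    where
    open ForkMutation (IsFork-negate F) k≢r (neg-mono-< k→r)
    flip : ∀ {v} → mutate (inj₁ k) (negate B) v (inj₁ r) ≤ 0ℤ → 0ℤ ≤ mutate (inj₁ k) B v (inj₁ r)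
    flip {v} h = neg-cancel-≤ {_} {0ℤ} (subst (_≤ 0ℤ) (mutate-negate (inj₁ k) B v (inj₁ r)) h)

  frame-skew : ∀ {m} {Q : Quiver (Fin m)} → IsSkew Q → IsSkew (frame Q)
  frame-skew skew (inj₁ x) (inj₁ y) = skew x y
  frame-skew _ (inj₁ x) (inj₂ y) with x ≟F y | y ≟F x
  ... | yes _ | yes _ = refl
  ... | yes x≡y | no y≢x = ⊥-elim (y≢x (sym x≡y))
  ... | no x≢y | yes y≡x = ⊥-elim (x≢y (sym y≡x))
  ... | no _ | no _ = refl
  frame-skew _ (inj₂ x) (inj₁ y) with x ≟F y | y ≟F x
  ... | yes _ | yes _ = refl
  ... | yes x≡y | no y≢x = ⊥-elim (y≢x (sym x≡y))
  ... | no x≢y | yes y≡x = ⊥-elim (x≢y (sym y≡x))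
  ... | no _ | no _ = refl
  frame-skew _ (inj₂ x) (inj₂ y) = refl

  frame-frozen-row≤0 : ∀ {m} (Q : Quiver (Fin m)) x v → frame Q (inj₂ x) v ≤ 0ℤ
  frame-frozen-row≤0 Q x (inj₁ y) with x ≟F y
  ... | yes _ = -≤+
  ... | no _ = ≤-refl
  frame-frozen-row≤0 Q x (inj₂ y) = ≤-refl

  module FirstMutation {m} {Q : Quiver (Fin (suc m))} (skew : IsSkew Q) (abundant : Abundant Q)
                       (decreasing : HasDecreasingAcyclicOrder Q) where
    Z : FV (suc m)
    Z = inj₁ zero

    B₁ : Quiver (FV (suc m))
    B₁ = mutate Z (frame Q)

    B₁-skew : IsSkew B₁
    B₁-skew = mutate-skew Z (frame Q) (frame-skew skew)

    into-zero : ∀ x → x ≢ zero → 0ℤ < Q x zero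
    into-zero zero x≢0 = ⊥-elim (x≢0 refl)
    into-zero (suc x) _ = decreasing (suc x) zero (s≤s z≤n)

    B₁-off-zero : ∀ {x y} → x ≢ zero → y ≢ zero → B₁ (inj₁ x) (inj₁ y) ≡ Q x y
    B₁-off-zero {x} {y} x≢0 y≢0 =
      trans (mutate-off Z (frame Q) (x≢0 ∘ inj₁-injective) (y≢0 ∘ inj₁-injective))
            (μ-rule-nonneg-nonpos (<⇒≤ (into-zero x x≢0)) (<⇒≤ (skew-pos skew (into-zero y y≢0))))

    into-Z : ∀ {v} → 0ℤ < B₁ v Z → v ≡ inj₂ zero
    into-Z {inj₁ zero} h = ⊥-elim (skew-pos⇒≢ B₁-skew {Z} h refl)
    into-Z {inj₁ (suc x)} h = ⊥-elim (<-asym h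
      (subst (_< 0ℤ) (sym (mutate-column Z (frame Q) {inj₁ (suc x)} λ ()))
             (neg-mono-< (into-zero (suc x) λ ()))))
    into-Z {inj₂ zero} _ = refl
    into-Z {inj₂ (suc y)} h =
      ⊥-elim (<-irrefl refl (subst (0ℤ <_) (mutate-column Z (frame Q) {inj₂ (suc y)} λ ()) h))

    dominates-frozen-arrow : ∀ w → Mutable w → 0ℤ < B₁ Z w → B₁ (inj₂ zero) Z ≤ B₁ w (inj₂ zero)
    dominates-frozen-arrow (inj₁ zero) _ h = ⊥-elim (skew-pos⇒≢ B₁-skew {Z} h refl)
    dominates-frozen-arrow (inj₁ (suc y)) _ _ =
      subst₂ _≤_ (sym (mutate-column Z (frame Q) {inj₂ zero} λ ())) (sym B₁[y,0′]) (i<j⇒suc[i]≤j y→0)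
      where
      y→0 : 0ℤ < Q (suc y) zero
      y→0 = into-zero (suc y) λ ()
      B₁[y,0′] : B₁ (inj₁ (suc y)) (inj₂ zero) ≡ Q (suc y) zero
      B₁[y,0′] = begin
        B₁ (inj₁ (suc y)) (inj₂ zero)    ≡⟨ mutate-off Z (frame Q) {inj₁ (suc y)} {inj₂ zero} (λ ()) (λ ()) ⟩
        μ-rule (Q (suc y) zero) 1ℤ 0ℤ    ≡⟨ μ-rule-nonneg-nonneg {b = 0ℤ} (<⇒≤ y→0) (+≤+ z≤n) ⟩
        0ℤ + Q (suc y) zero * 1ℤ         ≡⟨ trans (+-identityˡ _) (*-identityʳ _) ⟩
        Q (suc y) zero                   ∎
        where open ≡-Reasoning

    B₁-closing-arrow-dominates : ∀ v w → 0ℤ < B₁ v Z → 0ℤ < B₁ Z w →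
      (Mutable w → B₁ v Z ≤ B₁ w v) × (Mutable v → B₁ Z w ≤ B₁ w v)
    B₁-closing-arrow-dominates v w v→0 0→w with into-Z {v} v→0
    ... | refl = (λ mw → dominates-frozen-arrow w mw 0→w) , λ ()

    height : FV (suc m) → ℕ
    height (inj₁ x) = suc (toℕ x)
    height (inj₂ _) = zero

    B₁-descends : ∀ {a b} → a ≢ Z → b ≢ Z → 0ℤ < B₁ a b → height b ℕ.< height a
    B₁-descends {inj₂ x} {b} _ b≢Z h = ⊥-elim (<-irrefl refl (<-≤-trans h
      (≤-trans (subst (_≤ frame Q (inj₂ x) b) (sym (mutate-off Z (frame Q) {inj₂ x} (λ ()) b≢Z))
                 (μ-rule-≤ {c = frame Q Z b} (inj₁ (frame-frozen-row≤0 Q x Z))))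
               (frame-frozen-row≤0 Q x b))))
    B₁-descends {inj₁ x} {inj₂ y} _ _ _ = s≤s z≤n
    B₁-descends {inj₁ x} {inj₁ y} a≢Z b≢Z h with ℕₚ.<-cmp (toℕ y) (toℕ x)
    ... | tri< y<x _ _ = s≤s y<x
    ... | tri≈ _ y≡x _ =
      ⊥-elim (skew-pos⇒≢ B₁-skew {inj₁ x} {inj₁ y} h (cong inj₁ (toℕ-injective (sym y≡x))))
    ... | tri> _ _ x<y = ⊥-elim (skew-asym skew
                           (subst (0ℤ <_) (B₁-off-zero (a≢Z ∘ cong inj₁) (b≢Z ∘ cong inj₁)) h)
                           (decreasing y x x<y))

    B₁-acyclic : ∀ u v w → u ≢ Z → v ≢ Z → w ≢ Z → TwoMutable u v w →
                 0ℤ < B₁ u v → 0ℤ < B₁ v w → 0ℤ < B₁ w u → ⊥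
    B₁-acyclic u v w u≢Z v≢Z w≢Z _ h₁ h₂ h₃ = ℕₚ.<-irrefl refl
      (ℕₚ.<-trans (B₁-descends w≢Z u≢Z h₃)
        (ℕₚ.<-trans (B₁-descends v≢Z w≢Z h₂) (B₁-descends u≢Z v≢Z h₁)))

    first-fork : IsFork B₁ zero
    first-fork = record
      { skew = B₁-skew
      ; abundant = mutate-abundant abundant
          (λ x≢y x≢0 y≢0 → subst AbundantEntry (sym (B₁-off-zero x≢0 y≢0)) (abundant _ _ x≢y))
      ; closing-arrow-dominates = B₁-closing-arrow-dominates
      ; acyclic-off-return = B₁-acyclic
      }

  -- Triangular mutation sequences

  AgreeOn : ∀ {m} → (FV m → Set) → Quiver (FV m) → Quiver (FV m) → Set
  AgreeOn P B B′ = ∀ {v w} → P v → P w → B v w ≡ B′ v w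

  module _ {m} {P : FV m → Set} where
    mutate-agree : ∀ {x B B′} → P x → AgreeOn P B B′ → AgreeOn P (mutate x B) (mutate x B′)
    mutate-agree {x} Px agree {v} {w} Pv Pw with v ≟V x | w ≟V x
    ... | yes _ | _ = cong -_ (agree Pv Pw)
    ... | no _ | yes _ = cong -_ (agree Pv Pw)
    ... | no _ | no _ rewrite agree Pv Px | agree Px Pw | agree Pv Pw = refl

    mutateSeq-agree : ∀ {ks B B′} → All (P ∘ inj₁) ks → AgreeOn P B B′ →
                      AgreeOn P (mutateSeq ks B) (mutateSeq ks B′)
    mutateSeq-agree [] agree = agree
    mutateSeq-agree (Pk ∷ Pks) agree = mutateSeq-agree Pks (mutate-agree Pk agree)

  module _ {X : Set} {x : X} where
    FirstAt-∷ : ∀ {k a L} → x ≢ k → FirstAt x a L → FirstAt x (suc a) (k ∷ L)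
    FirstAt-∷ x≢k (x-at-a , none-before) = x-at-a , λ
      { zero _ x≡k → x≢k x≡k
      ; (suc b) (s≤s b<a) x-at-b → none-before b b<a x-at-b }

    Appears-∷⁻ : ∀ {k L} → x ≢ k → Appears x (k ∷ L) → Appears x L
    Appears-∷⁻ x≢k (zero , x≡k) = ⊥-elim (x≢k x≡k)
    Appears-∷⁻ _ (suc a , x-at-a) = a , x-at-a

    first-appearance : DecidableEquality X → ∀ L → Appears x L → Σ ℕ λ a → FirstAt x a L
    first-appearance _≟_ (k ∷ L) app with x ≟ k
    ... | yes x≡k = zero , x≡k , λ _ ()
    ... | no x≢k with first-appearance _≟_ L (Appears-∷⁻ x≢k app)
    ...   | a , first = suc a , FirstAt-∷ x≢k first

  -- The vertex labelled i in the paper has index i - 1, so n + 1 is the apex fromℕ n.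
  module Frontier (n : ℕ) where
    Vertex : Set
    Vertex = Fin (suc n)

    apex : Vertex
    apex = fromℕ n

    A : FV (suc n)
    A = inj₁ apex

    Unmutated : ℕ → FV (suc n) → Set
    Unmutated p (inj₁ x) = p ℕ.≤ toℕ x
    Unmutated p (inj₂ _) = ⊤

    Unmutated-weaken : ∀ {p q} → p ℕ.≤ q → ∀ o → Unmutated q o → Unmutated p o
    Unmutated-weaken p≤q (inj₁ x) q≤x = ℕₚ.≤-trans p≤q q≤x
    Unmutated-weaken _ (inj₂ _) _ = tt

    Unmutated-apex : ∀ {p} → p ℕ.≤ n → Unmutated p A
    Unmutated-apex p≤n = subst (_ ℕ.≤_) (sym (toℕ-fromℕ n)) p≤n

    mutated≢unmutated : ∀ {p j} → toℕ j ℕ.< p → ∀ o → Unmutated p o → o ≢ inj₁ j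
    mutated≢unmutated j<p (inj₁ x) p≤x refl = ℕₚ.<-irrefl refl (ℕₚ.<-≤-trans j<p p≤x)
    mutated≢unmutated _ (inj₂ _) _ ()

    apex≢mutated : ∀ {p j} → p ℕ.≤ n → toℕ j ℕ.< p → A ≢ inj₁ j
    apex≢mutated p≤n j<p = mutated≢unmutated j<p A (Unmutated-apex p≤n)

    data Step (p : ℕ) (k : Vertex) : ℕ → Set where
      revisit : toℕ k ℕ.< p → Step p k p
      visit : toℕ k ≡ p → p ℕ.< n → Step p k (suc p)

    module _ {p : ℕ} {k : Vertex} {p′ : ℕ} where
      Step-≤ : Step p k p′ → p ℕ.≤ p′
      Step-≤ (revisit _) = ℕₚ.≤-refl
      Step-≤ (visit _ _) = ℕₚ.n≤1+n p

      Step-bound : p ℕ.≤ n → Step p k p′ → p′ ℕ.≤ n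
      Step-bound p≤n (revisit _) = p≤n
      Step-bound _ (visit _ p<n) = p<n

      Step-mutated : Step p k p′ → toℕ k ℕ.< p′
      Step-mutated (revisit k<p) = k<p
      Step-mutated (visit k≡p _) = ℕₚ.≤-reflexive (cong suc k≡p)

      Step-earlier : Step p k p′ → ∀ {j} → toℕ j ℕ.< p′ → j ≢ k → toℕ j ℕ.< p
      Step-earlier (revisit _) j<p _ = j<p
      Step-earlier (visit k≡p _) j<1+p j≢k =
        ℕₚ.≤∧≢⇒< (ℕₚ.≤-pred j<1+p) (λ j≡p → j≢k (toℕ-injective (trans j≡p (sym k≡p))))

    -- The vertices of index below p have been mutated, r most recently; every other mutated
    -- vertex sees all unmutated and frozen vertices on the same side as the apex.
    record Stage (B : Quiver (FV (suc n))) (r : Vertex) (p : ℕ) : Set where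
      field
        fork : IsFork B r
        r<p : toℕ r ℕ.< p
        p≤n : p ℕ.≤ n
        coherent : ∀ j o → toℕ j ℕ.< p → j ≢ r → Unmutated p o →
                   SameSide (B o (inj₁ j)) (B A (inj₁ j))

    Stage-negate : ∀ {B r p} → Stage B r p → Stage (negate B) r p
    Stage-negate St = record
      { fork = IsFork-negate fork
      ; r<p = r<p
      ; p≤n = p≤n
      ; coherent = λ j o j<p j≢r o-un → SameSide-neg (coherent j o j<p j≢r o-un)
      }
      where open Stage St

    module Coherence {B r p} (St : Stage B r p) {k} (k≢r : k ≢ r)
                     {j} (j<p : toℕ j ℕ.< p) (j≢r : j ≢ r) where
      open Stage St
      open IsFork fork

      J K : FV (suc n)
      J = inj₁ j
      K = inj₁ k

      A-unmutated : Unmutated p A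
      A-unmutated = Unmutated-apex p≤n

      -- If k was mutated before, o and A lie on the same side of k, and K → A would close the
      -- cycle A → J → K; if k is new, K itself is unmutated and so lies on A's side of j.
      into-K-nonneg : ∀ {p′} → Step p k p′ → 0ℤ < B A J → 0ℤ < B J K →
                      ∀ {o} → Unmutated p o → 0ℤ ≤ B o K
      into-K-nonneg (revisit k<p) a→j j→k {o} o-un with coherent k o k<p k≢r o-un
      ... | inj₁ (0≤B[o,K] , _) = 0≤B[o,K]
      ... | inj₂ (_ , B[A,K]≤0) =
        ⊥-elim (acyclic-off-return A J K (apex≢mutated p≤n r<p) (j≢r ∘ inj₁-injective)
                  (k≢r ∘ inj₁-injective) (inj₁ (tt , tt)) a→j j→k
                  (skew-neg skew (≤∧≢⇒< B[A,K]≤0 B[A,K]≢0)))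
        where
        B[A,K]≢0 : B A K ≢ 0ℤ
        B[A,K]≢0 = AbundantEntry⇒≢0 (abundant-mutable tt tt (apex≢mutated p≤n k<p))
      into-K-nonneg (visit k≡p _) a→j j→k _ =
        ⊥-elim (<-irrefl refl (<-≤-trans (skew-pos skew j→k)
                  (SameSide-nonneg (coherent j K j<p j≢r (ℕₚ.≤-reflexive (sym k≡p))) a→j)))

      into-K-or-into-J : ∀ {p′} → Step p k p′ → 0ℤ < B A J →
                         ∀ {o} → Unmutated p o → 0ℤ ≤ B o K ⊎ 0ℤ ≤ B K J
      into-K-or-into-J step a→j o-un with 0ℤ <? B J K
      ... | yes j→k = inj₁ (into-K-nonneg step a→j j→k o-un)
      ... | no j↛k = inj₂ (subst (0ℤ ≤_) (sym (skew K J)) (neg-mono-≤ (≮⇒≥ j↛k)))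

      stays-nonneg : ∀ {p′} → Step p k p′ → j ≢ k → 0ℤ < B A J →
                     ∀ o → Unmutated p o → o ≢ K → 0ℤ ≤ mutate K B o J
      stays-nonneg step j≢k a→j o o-un o≢K =
        subst (0ℤ ≤_) (sym (mutate-off K B o≢K (j≢k ∘ inj₁-injective)))
          (≤-trans (SameSide-nonneg (coherent j o j<p j≢r o-un) a→j)
                   (μ-rule-≥ (into-K-or-into-J step a→j o-un)))

    coherent-off-return : ∀ {B r p k p′} → Stage B r p → k ≢ r → Step p k p′ →
      ∀ {j} → toℕ j ℕ.< p → j ≢ r → j ≢ k → ∀ o → Unmutated p o → o ≢ inj₁ k →
      SameSide (mutate (inj₁ k) B o (inj₁ j)) (mutate (inj₁ k) B A (inj₁ j))
    coherent-off-return {B} {k = k} St k≢r step {j} j<p j≢r j≢k o o-un o≢K =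
      by-sign (IsFork.sign-between-mutable fork tt tt (apex≢mutated p≤n j<p))
      where
      open Stage St
      module C = Coherence St k≢r j<p j≢r
      module C⁻ = Coherence (Stage-negate St) k≢r j<p j≢r
      A≢K : A ≢ inj₁ k
      A≢K = apex≢mutated (Step-bound p≤n step) (Step-mutated step)
      flip : ∀ v → 0ℤ ≤ mutate (inj₁ k) (negate B) v (inj₁ j) → mutate (inj₁ k) B v (inj₁ j) ≤ 0ℤ
      flip v h = neg-cancel-≤ {0ℤ} (subst (0ℤ ≤_) (mutate-negate (inj₁ k) B v (inj₁ j)) h)
      by-sign : 0ℤ < B A (inj₁ j) ⊎ B A (inj₁ j) < 0ℤ →
                SameSide (mutate (inj₁ k) B o (inj₁ j)) (mutate (inj₁ k) B A (inj₁ j))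
      by-sign (inj₁ a→j) = inj₁ (C.stays-nonneg step j≢k a→j o o-un o≢K ,
                                 C.stays-nonneg step j≢k a→j A C.A-unmutated A≢K)
      by-sign (inj₂ j→a) =
        inj₂ (flip o (C⁻.stays-nonneg step j≢k (neg-mono-< j→a) o o-un o≢K) ,
              flip A (C⁻.stays-nonneg step j≢k (neg-mono-< j→a) A C.A-unmutated A≢K))

    stage-step : ∀ {B r p k p′} → Stage B r p → k ≢ r → Step p k p′ → Stage (mutate (inj₁ k) B) k p′
    stage-step {B} {r} {k = k} {p′} St k≢r step = record
      { fork = mutate-fork fork k≢r
      ; r<p = Step-mutated step
      ; p≤n = Step-bound p≤n step
      ; coherent = coherent′
      }
      where
      open Stage St
      coherent′ : ∀ j o → toℕ j ℕ.< p′ → j ≢ k → Unmutated p′ o →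
                  SameSide (mutate (inj₁ k) B o (inj₁ j)) (mutate (inj₁ k) B A (inj₁ j))
      coherent′ j o j<p′ j≢k o-un with j ≟F r
      ... | yes refl = mutate-fork-old-return fork k≢r o≢K A≢K
        where
        o≢K : o ≢ inj₁ k
        o≢K = mutated≢unmutated (Step-mutated step) o o-un
        A≢K : A ≢ inj₁ k
        A≢K = apex≢mutated (Step-bound p≤n step) (Step-mutated step)
      ... | no j≢r = coherent-off-return St k≢r step (Step-earlier step j<p′ j≢k) j≢r j≢k o
                       (Unmutated-weaken (Step-≤ step) o o-un)
                       (mutated≢unmutated (Step-mutated step) o o-un)

    revisit-invisible : ∀ {B r p k} → Stage B r p → toℕ k ℕ.< p → k ≢ r →
                        AgreeOn (Unmutated p) (mutate (inj₁ k) B) B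
    revisit-invisible {B} {k = k} St k<p k≢r {o₁} {o₂} o₁-un o₂-un =
      trans (mutate-off K B (mutated≢unmutated k<p o₁ o₁-un) (mutated≢unmutated k<p o₂ o₂-un))
            (by-sign (IsFork.sign-between-mutable fork tt tt (apex≢mutated p≤n k<p)))
      where
      open Stage St
      K : FV (suc n)
      K = inj₁ k
      side₁ : SameSide (B o₁ K) (B A K)
      side₁ = coherent k o₁ k<p k≢r o₁-un
      side₂ : SameSide (B o₂ K) (B A K)
      side₂ = coherent k o₂ k<p k≢r o₂-un
      by-sign : 0ℤ < B A K ⊎ B A K < 0ℤ → μ-rule (B o₁ K) (B K o₂) (B o₁ o₂) ≡ B o₁ o₂
      by-sign (inj₁ a→k) = μ-rule-nonneg-nonpos (SameSide-nonneg side₁ a→k)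
        (subst (_≤ 0ℤ) (sym (IsFork.skew fork K o₂)) (neg-mono-≤ (SameSide-nonneg side₂ a→k)))
      by-sign (inj₂ k→a) = μ-rule-nonpos-nonneg (SameSide-nonpos side₁ k→a)
        (subst (0ℤ ≤_) (sym (IsFork.skew fork K o₂)) (neg-mono-≤ (SameSide-nonpos side₂ k→a)))

    -- The fallback value is never used: vertex is only applied to q ≤ n.
    vertex : ℕ → Vertex
    vertex q with q ℕ.<? suc n
    ... | yes q<1+n = fromℕ< q<1+n
    ... | no _ = apex

    toℕ-vertex : ∀ {q} → q ℕ.≤ n → toℕ (vertex q) ≡ q
    toℕ-vertex {q} q≤n with q ℕ.<? suc n
    ... | yes q<1+n = toℕ-fromℕ< q<1+n
    ... | no q≮1+n = ⊥-elim (q≮1+n (s≤s q≤n))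

    ascending : ℕ → ℕ → List Vertex
    ascending zero _ = []
    ascending (suc d) q = vertex q ∷ ascending d (suc q)

    canonical : ℕ → List Vertex
    canonical p = ascending (n ∸ p) p

    ascending-unmutated : ∀ d {p q} → p ℕ.≤ q → d ℕ.+ q ℕ.≤ n →
                          All (Unmutated p ∘ inj₁) (ascending d q)
    ascending-unmutated zero _ _ = []
    ascending-unmutated (suc d) {p} {q} p≤q d+q<n =
      subst (p ℕ.≤_) (sym (toℕ-vertex (ℕₚ.≤-trans (ℕₚ.m≤n+m q (suc d)) d+q<n))) p≤q ∷
      ascending-unmutated d (ℕₚ.m≤n⇒m≤1+n p≤q) (subst (ℕ._≤ n) (sym (ℕₚ.+-suc d q)) d+q<n)

    canonical-unmutated : ∀ {p} → p ℕ.≤ n → All (Unmutated p ∘ inj₁) (canonical p)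
    canonical-unmutated {p} p≤n =
      ascending-unmutated (n ∸ p) ℕₚ.≤-refl (ℕₚ.≤-reflexive (ℕₚ.m∸n+n≡m p≤n))

    canonical-visit : ∀ {p k} → toℕ k ≡ p → p ℕ.< n → canonical p ≡ k ∷ canonical (suc p)
    canonical-visit {p} k≡p p<n rewrite ℕₚ.+-∸-assoc 1 p<n =
      cong (_∷ canonical (suc p)) (toℕ-injective (trans (toℕ-vertex (ℕₚ.<⇒≤ p<n)) (sym k≡p)))

    data Schedule : ℕ → List Vertex → Set where
      done : Schedule n []
      _∷_ : ∀ {p k p′ ks} → Step p k p′ → Schedule p′ ks → Schedule p (k ∷ ks)

    -- A revisit leaves the arrows among unmutated vertices unchanged, and the canonical sequence
    -- mutates only at unmutated vertices, so it cannot tell the quiver before and after apart.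
    apex-row-canonical : ∀ {B r p ks} → Stage B r p → NoRepeat (r ∷ ks) → Schedule p ks →
      ∀ y → mutateSeq ks B A (inj₂ y) ≡ mutateSeq (canonical p) B A (inj₂ y)
    apex-row-canonical _ _ done y rewrite ℕₚ.n∸n≡0 n = refl
    apex-row-canonical St (r≢k , no-repeat) (revisit k<p ∷ schedule) y =
      trans (apex-row-canonical (stage-step St (r≢k ∘ sym) (revisit k<p)) no-repeat schedule y)
            (mutateSeq-agree (canonical-unmutated p≤n) (revisit-invisible St k<p (r≢k ∘ sym))
                             (Unmutated-apex p≤n) tt)
      where open Stage St
    apex-row-canonical {B} St (r≢k , no-repeat) (visit k≡p p<n ∷ schedule) y =
      trans (apex-row-canonical (stage-step St (r≢k ∘ sym) (visit k≡p p<n)) no-repeat schedule y)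
            (cong (λ ks → mutateSeq ks B A (inj₂ y)) (sym (canonical-visit k≡p p<n)))

    -- Triangularity of a suffix of a sequence, once the vertices of index below p have been seen.
    record TriangularFrom (p : ℕ) (L : List Vertex) : Set where
      field
        ordered : ∀ x y a b → FirstAt x a L → FirstAt y b L → a ℕ.< b →
                  p ℕ.≤ toℕ x → p ℕ.≤ toℕ y → toℕ x ℕ.< toℕ y
        complete : ∀ x → p ℕ.≤ toℕ x → toℕ x ℕ.< n → Appears x L
        bounded : ∀ x → Appears x L → toℕ x ℕ.< n
        p≤n : p ℕ.≤ n

    frontier-appears : ∀ {p L} → TriangularFrom p L → p ℕ.< n → Appears (vertex p) L
    frontier-appears {p} T p<n =
      TriangularFrom.complete T (vertex p) (ℕₚ.≤-reflexive (sym vp≡p)) (subst (ℕ._< n) (sym vp≡p) p<n)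
      where
      vp≡p : toℕ (vertex p) ≡ p
      vp≡p = toℕ-vertex (ℕₚ.<⇒≤ p<n)

    module _ {p k L} (T : TriangularFrom p (k ∷ L)) where
      open TriangularFrom T

      head-not-beyond-frontier : ¬ (p ℕ.< toℕ k)
      head-not-beyond-frontier p<k =
        from-first-appearance (first-appearance _≟F_ (k ∷ L) (frontier-appears T p<n))
        where
        p<n : p ℕ.< n
        p<n = ℕₚ.<-trans p<k (bounded k (zero , refl))
        vp≡p : toℕ (vertex p) ≡ p
        vp≡p = toℕ-vertex (ℕₚ.<⇒≤ p<n)
        from-first-appearance : Σ ℕ (λ a → FirstAt (vertex p) a (k ∷ L)) → ⊥
        from-first-appearance (zero , vp≡k , _) = ℕₚ.<-irrefl (trans (sym vp≡p) (cong toℕ vp≡k)) p<k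
        from-first-appearance (suc a , first) = ℕₚ.<-asym p<k (subst (toℕ k ℕ.<_) vp≡p
          (ordered k (vertex p) zero (suc a) (refl , λ _ ()) first (s≤s z≤n)
                   (ℕₚ.<⇒≤ p<k) (ℕₚ.≤-reflexive (sym vp≡p))))

      head-step : Σ ℕ (Step p k)
      head-step with toℕ k ℕ.<? p
      ... | yes k<p = p , revisit k<p
      ... | no k≮p = suc p , visit k≡p (subst (ℕ._< n) k≡p (bounded k (zero , refl)))
        where
        k≡p : toℕ k ≡ p
        k≡p = ℕₚ.≤-antisym (ℕₚ.≮⇒≥ head-not-beyond-frontier) (ℕₚ.≮⇒≥ k≮p)

      tail-triangular : ∀ {p′} → Step p k p′ → TriangularFrom p′ L
      tail-triangular {p′} step = record
        { ordered = λ x y a b fx fy a<b p′≤x p′≤y →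
            ordered x y (suc a) (suc b) (FirstAt-∷ (later≢k p′≤x) fx) (FirstAt-∷ (later≢k p′≤y) fy)
                    (s≤s a<b)
                    (ℕₚ.≤-trans (Step-≤ step) p′≤x) (ℕₚ.≤-trans (Step-≤ step) p′≤y)
        ; complete = λ x p′≤x x<n →
            Appears-∷⁻ (later≢k p′≤x) (complete x (ℕₚ.≤-trans (Step-≤ step) p′≤x) x<n)
        ; bounded = λ { x (a , x-at-a) → bounded x (suc a , x-at-a) }
        ; p≤n = Step-bound p≤n step
        }
        where
        later≢k : ∀ {x} → p′ ℕ.≤ toℕ x → x ≢ k
        later≢k {x} p′≤x = mutated≢unmutated (Step-mutated step) (inj₁ x) p′≤x ∘ cong inj₁

    triangular-schedule : ∀ {p} L → TriangularFrom p L → Schedule p L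
    triangular-schedule [] T with ℕₚ.m≤n⇒m<n∨m≡n (TriangularFrom.p≤n T)
    ... | inj₂ refl = done
    ... | inj₁ p<n = ⊥-elim (proj₂ (frontier-appears T p<n))
    triangular-schedule (k ∷ L) T =
      proj₂ (head-step T) ∷ triangular-schedule L (tail-triangular T (proj₂ (head-step T)))

    module _ {Q : Quiver Vertex} (skew : IsSkew Q) (abundant : Abundant Q)
             (decreasing : HasDecreasingAcyclicOrder Q) where
      open FirstMutation skew abundant decreasing

      first-stage : 1 ℕ.≤ n → Stage B₁ zero 1
      first-stage 1≤n = record
        { fork = first-fork
        ; r<p = s≤s z≤n
        ; p≤n = 1≤n
        ; coherent = λ { zero _ _ 0≢0 _ → ⊥-elim (0≢0 refl) ; (suc _) _ (s≤s ()) _ _ }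
        }

      triangular-from-zero : ∀ {is} → Triangular is → (∀ x → toℕ x ℕ.< n → Appears x is) →
                             ¬ Appears apex is → TriangularFrom 0 is
      triangular-from-zero {is} T complete missing = record
        { ordered = λ x y a b fx fy a<b _ _ → proj₂ T x y a b fx fy a<b
        ; complete = λ x _ → complete x
        ; bounded = λ x app → ℕₚ.≤∧≢⇒< (ℕₚ.≤-pred (toℕ<n x))
            (λ x≡n → missing (subst (λ v → Appears v is)
                                     (toℕ-injective (trans x≡n (sym (toℕ-fromℕ n)))) app))
        ; p≤n = z≤n
        }

      canonical-c-vector : 1 ℕ.≤ n → ∀ is → Triangular is → (∀ x → toℕ x ℕ.< n → Appears x is) →
                           ¬ Appears apex is → ∀ y → cvec Q is apex y ≡ cvec Q (canonical 0) apex y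
      canonical-c-vector 1≤n [] _ complete _ _ = ⊥-elim (proj₂ (complete zero 1≤n))
      canonical-c-vector 1≤n (k ∷ rest) T complete missing y
        with triangular-from-zero T complete missing
      ... | T₀ with head-step T₀
      ...   | _ , revisit ()
      ...   | _ , visit k≡0 0<n with toℕ-injective {i = k} {j = zero} k≡0
      ...     | refl = begin
        cvec Q (zero ∷ rest) apex y
          ≡⟨ apex-row-canonical (first-stage 1≤n) (proj₁ T)
               (triangular-schedule rest (tail-triangular T₀ (visit k≡0 0<n))) y ⟩
        mutateSeq (canonical 1) B₁ A (inj₂ y)
          ≡⟨ cong (λ ks → mutateSeq ks (frame Q) A (inj₂ y)) (sym (canonical-visit refl 0<n)) ⟩
        cvec Q (canonical 0) apex y ∎
        where open ≡-Reasoning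

open import Data.Nat using (ℕ; suc; _<_)
open import Data.Fin using (Fin; toℕ; fromℕ)
open import Data.List using (List)
open import Data.Integer using (ℤ)
open import Relation.Nullary using (¬_)
open import Relation.Binary.PropositionalEquality using (_≡_; trans; sym)

proposition5p24 : (n : ℕ) → 1 Data.Nat.≤ n → (Q : Quiver (Fin (suc n))) →
    IsSkew Q → Abundant Q → HasDecreasingAcyclicOrder Q →
    (is is′ : List (Fin (suc n))) →
    Triangular is → (∀ (x : Fin (suc n)) → toℕ x < n → Appears x is) → ¬ Appears (fromℕ n) is →
    Triangular is′ → (∀ (x : Fin (suc n)) → toℕ x < n → Appears x is′) → ¬ Appears (fromℕ n) is′ →
    ∀ (y : Fin (suc n)) → cvec Q is (fromℕ n) y ≡ cvec Q is′ (fromℕ n) y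
proposition5p24 n 1≤n Q skew abundant decreasing is is′ T complete missing T′ complete′ missing′ y =
  trans (canonical-c-vector skew abundant decreasing 1≤n is T complete missing y)
        (sym (canonical-c-vector skew abundant decreasing 1≤n is′ T′ complete′ missing′ y))
  where open Frontier n
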